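{- Let $x$ be a sequence of pairwise distinct integers of length $m$, $i\in\{1,\ldots,m-1\}$ and $y=\tau(x,i)$. Then there are at most $3$ positions $j$ with $SN_x[j]\neq SN_y[j]$, and every such position belongs to $\{i,\ i+1,\ \mathrm{ref}_x(i),\ \mathrm{ref}_x(i+1),\ \mathrm{ref}_y(i),\ \mathrm{ref}_y(i+1)\}$.
   Context: $\tau(x,i)$ exchanges $x[i]$ and $x[i+1]$. The Cartesian tree $C(x)$ of $x[1\ldots m]$ has as root the node labeled by the position $g$ of the minimum of $x$, left subtree $C(x[1\ldots g-1])$ and right subtree the Cartesian tree of $x[g+1\ldots m]$ (nodes labeled by positions). $C_h(x)$ is the subtree rooted at node $h$. $SN_x[h]$ is the number of nodes on the right branch (root and successive right children) of the left subtree of $C_h(x)$ ($0$ if that subtree is empty). $\mathrm{ref}_x(h)$ is the smallest position $j>h$ with $x[j]<x[h]$, and $-1$ if none exists. -}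

module Defs where

open import Data.Nat using (ℕ; zero; suc; _+_)
open import Data.Integer using (ℤ; _<?_)
open import Data.List using (List; []; _∷_; take; drop; length)
open import Data.Maybe using (Maybe; just; nothing)
open import Data.Product using (_×_; _,_)
open import Data.Bool using (if_then_else_)
open import Relation.Nullary using (does)

-- Sequences x[1..m] are lists of integers; positions are 1-based naturals.

nth : List ℤ → ℕ → Maybe ℤ
nth [] _ = nothing
nth (a ∷ as) zero = nothing
nth (a ∷ as) (suc zero) = just a
nth (a ∷ as) (suc (suc n)) = nth as (suc n)

τ : List ℤ → ℕ → List ℤ
τ (a ∷ b ∷ r) (suc zero) = b ∷ a ∷ r
τ (a ∷ r) (suc (suc n)) = a ∷ τ r (suc n)
τ x _ = x

data Tree : Set where
  leaf : Tree
  node : Tree → ℕ → Tree → Tree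

-- (minimum value, 0-based index of the minimum) of a non-empty list a ∷ as
amin : ℤ → List ℤ → ℤ × ℕ
amin a [] = a , 0
amin a (b ∷ bs) with amin b bs
... | v , k = if does (a <? v) then (a , 0) else (v , suc k)

argmin : ℤ → List ℤ → ℕ
argmin a as with amin a as
... | _ , k = k

-- Cartesian tree of a list whose first element sits at position off+1;
-- the fuel argument (≥ length) only ensures termination.
cartAux : ℕ → ℕ → List ℤ → Tree
cartAux zero off l = leaf
cartAux (suc f) off [] = leaf
cartAux (suc f) off (a ∷ as) =
  let g = argmin a as
      l = a ∷ as
  in node (cartAux f off (take g l)) (off + suc g) (cartAux f (off + suc g) (drop (suc g) l))

C : List ℤ → Tree
C x = cartAux (length x) 0 x

subtree : ℕ → Tree → Maybe Tree
subtree h leaf = nothing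
subtree h (node l k r) with h Data.Nat.≟ k
... | Relation.Nullary.yes _ = just (node l k r)
... | Relation.Nullary.no _ with subtree h l
...   | just t = just t
...   | nothing = subtree h r

rightBranch : Tree → ℕ
rightBranch leaf = 0
rightBranch (node l _ r) = suc (rightBranch r)

SN : List ℤ → ℕ → ℕ
SN x h with subtree h (C x)
... | just (node l _ _) = rightBranch l
... | just leaf = 0
... | nothing = 0

firstBelow : ℤ → ℕ → List ℤ → Maybe ℕ
firstBelow v k [] = nothing
firstBelow v k (a ∷ as) = if does (a <? v) then just k else firstBelow v (suc k) as

-- ref_x(h): smallest j > h with x[j] < x[h]; `nothing` plays the role of -1
ref : List ℤ → ℕ → Maybe ℕ
ref x h with nth x h
... | nothing = nothing
... | just v = firstBelow v (suc h) (drop h x)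

-- SN_x[j] is the number of suffix minima of x[1..j-1] (entries smaller than everything after
-- them) that exceed x[j]: the left subtree of node j is the Cartesian tree of the block between
-- the previous smaller entry and j, and the right branch of that tree is the chain of suffix
-- minima of the block.  Swapping x[i] and x[i+1] leaves the prefixes ending before i untouched.
-- For j > i+1 it changes the suffix minima of x[1..j-1] only in the larger swapped value b,
-- which is one of them exactly when b comes second and lies below x[i+2..j-1]; it then counts
-- for SN[j] iff x[j] < b, i.e. iff j = ref(i+1) in whichever of x, τ(x,i) has b at i+1.

module Submission where

open import Data.Empty using (⊥-elim)
open import Data.Integer as ℤ using (ℤ; _<?_)
import Data.Integer.Properties as ℤ
open import Data.List using (List; []; _∷_; [_]; _++_; length; take; drop; filter; map; upTo)
open import Data.List.Properties
  using (length-++; ++-assoc; ∷-injective; filter-++; filter-reject; filter-all; filter-none)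
open import Data.List.Relation.Binary.Permutation.Propositional using (↭-swap; ↭-refl; ↭⇒↭ₛ)
open import Data.List.Relation.Binary.Permutation.Propositional.Properties using (++⁺ˡ)
open import Data.List.Relation.Unary.All as All using (All; []; _∷_; all?)
import Data.List.Relation.Unary.All.Properties as All
open import Data.List.Relation.Unary.AllPairs using ([]; _∷_)
open import Data.List.Relation.Unary.Unique.Propositional using (Unique)
open import Data.List.Relation.Unary.Unique.Propositional.Properties using (map⁺; upTo⁺)
open import Data.Maybe using (just; nothing)
open import Data.Maybe.Properties as Maybe using (just-injective)
open import Data.Nat as ℕ using (ℕ; zero; suc; _+_; _≤_; _<_; _≟_; z≤n; s≤s)
open import Data.Nat.Properties
  using (≤-refl; ≤-reflexive; ≤-trans; <-trans; ≤-pred; ≤-<-trans; <⇒≢; ≮⇒≥; n≤1+n; n<1+n; m≤m+n; m≤n+m;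
         m<m+n; +-comm; +-assoc; +-suc; +-identityʳ; +-mono-≤; +-monoʳ-≤; +-monoʳ-<; suc-injective)
open import Data.Product using (_×_; _,_; Σ; ∃-syntax; proj₁; proj₂)
open import Data.Sum as Sum using (_⊎_; inj₁; inj₂; [_,_]′)
open import Function using (_∘_; id)
open import Level using (0ℓ)
open import Relation.Binary.Definitions using (tri<; tri≈; tri>)
open import Relation.Binary.PropositionalEquality
  using (_≡_; _≢_; refl; sym; trans; cong; subst; subst₂; ≢-sym; setoid; module ≡-Reasoning)
open import Data.List.Relation.Binary.Permutation.Setoid.Properties (setoid ℤ) using (Unique-resp-↭)
open import Relation.Nullary using (¬_; yes; no)
open import Relation.Nullary.Decidable using (¬?; _⊎-dec_)
open import Relation.Unary using (Pred; Decidable)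

open import Defs

split-at : ∀ {A : Set} n (xs : List A) → n < length xs →
  ∃[ p ] ∃[ v ] ∃[ s ] (xs ≡ p ++ v ∷ s × length p ≡ n)
split-at zero (v ∷ s) _ = [] , v , s , refl , refl
split-at (suc n) (c ∷ xs) (s≤s n<) with split-at n xs n<
... | p , v , s , refl , refl = c ∷ p , v , s , refl , refl

split-at-pair : ∀ {A : Set} n (xs : List A) → suc n < length xs →
  ∃[ P ] ∃[ a ] ∃[ b ] ∃[ Q ] (xs ≡ P ++ a ∷ b ∷ Q × length P ≡ n)
split-at-pair zero (a ∷ b ∷ Q) _ = [] , a , b , Q , refl , refl
split-at-pair zero (_ ∷ []) (s≤s ())
split-at-pair (suc n) (c ∷ xs) (s≤s n<) with split-at-pair n xs n<
... | P , a , b , Q , refl , refl = c ∷ P , a , b , Q , refl , refl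

data SplitOrder {A : Set} (p : List A) (v : A) (s : List A) (L : List A) (m : A) (R : List A) : Set where
  before : ∀ t → L ≡ p ++ v ∷ t → s ≡ t ++ m ∷ R → SplitOrder p v s L m R
  same   : p ≡ L → v ≡ m → s ≡ R → SplitOrder p v s L m R
  after  : ∀ t → p ≡ L ++ m ∷ t → R ≡ t ++ v ∷ s → SplitOrder p v s L m R

split-order : ∀ {A : Set} (p : List A) {v s} L {m R} → p ++ v ∷ s ≡ L ++ m ∷ R → SplitOrder p v s L m R
split-order [] [] refl = same refl refl refl
split-order [] (c ∷ L) refl = before L refl refl
split-order (c ∷ p) [] refl = after p refl refl
split-order (c ∷ p) (d ∷ L) eq with ∷-injective eq
... | refl , eq′ with split-order p L eq′
...   | before t refl e = before t refl e
...   | same refl e e′ = same refl e e′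
...   | after t refl e = after t refl e

[]≢++-∷ : ∀ {A : Set} (p : List A) {v s} → [] ≢ p ++ v ∷ s
[]≢++-∷ [] ()
[]≢++-∷ (_ ∷ _) ()

Unique-++-∷⁻ : ∀ {A : Set} L {m : A} {R} → Unique (L ++ m ∷ R) → Unique L × Unique R × All (_≢ m) L
Unique-++-∷⁻ [] (_ ∷ u) = [] , u , []
Unique-++-∷⁻ (c ∷ L) (c∉ ∷ u) with Unique-++-∷⁻ L u
... | uL , uR , L≢m = All.++⁻ˡ L c∉ ∷ uL , uR , All.head (All.++⁻ʳ L c∉) ∷ L≢m

Unique-swap : ∀ P {a b : ℤ} Q → Unique (P ++ a ∷ b ∷ Q) → Unique (P ++ b ∷ a ∷ Q)
Unique-swap P Q = Unique-resp-↭ (↭⇒↭ₛ (++⁺ˡ P (↭-swap _ _ ↭-refl)))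

length-filter-∷ : ∀ {A : Set} {P : Pred A 0ℓ} (P? : Decidable P) x xs →
  length (filter P? xs) ≤ length (filter P? (x ∷ xs))
length-filter-∷ P? x xs with P? x
... | yes _ = n≤1+n _
... | no _ = ≤-refl

length-filter-⊎ : ∀ {A : Set} {P Q R : Pred A 0ℓ} (P? : Decidable P) (Q? : Decidable Q) (R? : Decidable R) →
  (∀ {x} → P x → Q x ⊎ R x) →
  ∀ xs → length (filter P? xs) ≤ length (filter Q? xs) + length (filter R? xs)
length-filter-⊎ P? Q? R? split [] = z≤n
length-filter-⊎ P? Q? R? split (x ∷ xs) with P? x | length-filter-⊎ P? Q? R? split xs
... | no _ | ih = ≤-trans ih (+-mono-≤ (length-filter-∷ Q? x xs) (length-filter-∷ R? x xs))
... | yes px | ih with Q? x | R? x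
...   | yes _ | yes _ = s≤s (≤-trans ih (+-monoʳ-≤ _ (n≤1+n _)))
...   | yes _ | no _ = s≤s ih
...   | no _ | yes _ = ≤-trans (s≤s ih) (≤-reflexive (sym (+-suc _ _)))
...   | no ¬qx | no ¬rx = ⊥-elim ([ ¬qx , ¬rx ]′ (split px))

length-filter-≤1 : ∀ {A : Set} {P : Pred A 0ℓ} (P? : Decidable P) {xs} → Unique xs →
  (∀ {x y} → P x → P y → x ≡ y) → length (filter P? xs) ≤ 1
length-filter-≤1 P? [] _ = z≤n
length-filter-≤1 P? {x ∷ xs} (x∉xs ∷ u) one with P? x
... | no _ = length-filter-≤1 P? u one
... | yes px =
  s≤s (≤-reflexive (cong length (filter-none P? (All.map (λ x≢y py → x≢y (one px py)) x∉xs))))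

length-filter-≤3 : ∀ {P : Pred ℕ 0ℓ} (P? : Decidable P) {xs} → Unique xs → ∀ {k₁ k₂ r} →
  (∀ {j} → P j → j ≡ k₁ ⊎ j ≡ k₂ ⊎ just j ≡ r) → length (filter P? xs) ≤ 3
length-filter-≤3 P? {xs} u {k₁} {k₂} {r} candidates =
  ≤-trans (length-filter-⊎ P? (_≟ k₁) (λ j → (j ≟ k₂) ⊎-dec is-r j) candidates xs)
    (+-mono-≤ (length-filter-≤1 (_≟ k₁) u λ e e′ → trans e (sym e′))
      (≤-trans (length-filter-⊎ _ (_≟ k₂) is-r id xs)
        (+-mono-≤ (length-filter-≤1 (_≟ k₂) u λ e e′ → trans e (sym e′))
                  (length-filter-≤1 is-r u λ e e′ → just-injective (trans e (sym e′))))))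
  where
  is-r : Decidable (λ j → just j ≡ r)
  is-r j = Maybe.≡-dec _≟_ (just j) r

suffixMinima : List ℤ → List ℤ
suffixMinima [] = []
suffixMinima (c ∷ l) with all? (c <?_) l
... | yes _ = c ∷ suffixMinima l
... | no _ = suffixMinima l

countAbove : ℤ → List ℤ → ℕ
countAbove v l = length (filter (v <?_) l)

suffixMinima-keep : ∀ {c l} → All (c ℤ.<_) l → suffixMinima (c ∷ l) ≡ c ∷ suffixMinima l
suffixMinima-keep {c} {l} c<l with all? (c <?_) l
... | yes _ = refl
... | no c≮l = ⊥-elim (c≮l c<l)

suffixMinima-skip : ∀ {c l} → ¬ All (c ℤ.<_) l → suffixMinima (c ∷ l) ≡ suffixMinima l
suffixMinima-skip {c} {l} c≮l with all? (c <?_) l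
... | yes c<l = ⊥-elim (c≮l c<l)
... | no _ = refl

All-suffixMinima : ∀ {P : ℤ → Set} {l} → All P l → All P (suffixMinima l)
All-suffixMinima [] = []
All-suffixMinima {l = c ∷ l} (pc ∷ pl) with all? (c <?_) l
... | yes _ = pc ∷ All-suffixMinima pl
... | no _ = All-suffixMinima pl

suffixMinima-at-minimum : ∀ L {m R} → All (m ℤ.≤_) L → All (m ℤ.<_) R →
  suffixMinima (L ++ m ∷ R) ≡ m ∷ suffixMinima R
suffixMinima-at-minimum [] [] m<R = suffixMinima-keep m<R
suffixMinima-at-minimum (c ∷ L) (m≤c ∷ m≤L) m<R =
  trans (suffixMinima-skip (ℤ.≤⇒≯ m≤c ∘ All.head ∘ All.++⁻ʳ L))
        (suffixMinima-at-minimum L m≤L m<R)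

suffixMinima-remove : ∀ {c T} → ¬ All (c ℤ.<_) T → ∀ Q →
  suffixMinima (Q ++ c ∷ T) ≡ suffixMinima (Q ++ T)
suffixMinima-remove c≮T [] = suffixMinima-skip c≮T
suffixMinima-remove {c} {T} c≮T (d ∷ Q) with all? (d <?_) (Q ++ c ∷ T) | all? (d <?_) (Q ++ T)
... | yes _ | yes _ = cong (d ∷_) (suffixMinima-remove c≮T Q)
... | no _ | no _ = suffixMinima-remove c≮T Q
... | yes d<QcT | no d≮QT =
  ⊥-elim (d≮QT (All.++⁺ (All.++⁻ˡ Q d<QcT) (All.tail (All.++⁻ʳ Q d<QcT))))
... | no d≮QcT | yes d<QT = ⊥-elim (d≮QcT (All.++⁺ d<Q (d<c ∷ d<T)))
  where
  d<Q = All.++⁻ˡ Q d<QT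
  d<T = All.++⁻ʳ Q d<QT
  d<c : d ℤ.< c
  d<c with d <? c
  ... | yes d<c = d<c
  ... | no d≮c = ⊥-elim (c≮T (All.map (ℤ.≤-<-trans (ℤ.≮⇒≥ d≮c)) d<T))

suffixMinima-split : ∀ {c T} → All (c ℤ.<_) T → ∀ Q →
  suffixMinima (Q ++ c ∷ T) ≡ suffixMinima (Q ++ [ c ]) ++ suffixMinima T
suffixMinima-split c<T [] = suffixMinima-keep c<T
suffixMinima-split {c} {T} c<T (d ∷ Q) with all? (d <?_) (Q ++ c ∷ T) | all? (d <?_) (Q ++ [ c ])
... | yes _ | yes _ = cong (d ∷_) (suffixMinima-split c<T Q)
... | no _ | no _ = suffixMinima-split c<T Q
... | yes d<QcT | no d≮Qc =
  ⊥-elim (d≮Qc (All.++⁺ (All.++⁻ˡ Q d<QcT) (All.head (All.++⁻ʳ Q d<QcT) ∷ [])))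
... | no d≮QcT | yes d<Qc =
  ⊥-elim (d≮QcT (All.++⁺ (All.++⁻ˡ Q d<Qc) (d<c ∷ All.map (ℤ.<-trans d<c) c<T)))
  where
  d<c = All.head (All.++⁻ʳ Q d<Qc)

countAbove-skip : ∀ {v c} X Y → ¬ v ℤ.< c → countAbove v (X ++ c ∷ Y) ≡ countAbove v (X ++ Y)
countAbove-skip {v} {c} X Y v≮c = cong length (begin
  filter (v <?_) (X ++ c ∷ Y)                ≡⟨ filter-++ (v <?_) X (c ∷ Y) ⟩
  filter (v <?_) X ++ filter (v <?_) (c ∷ Y) ≡⟨ cong (filter (v <?_) X ++_) (filter-reject (v <?_) v≮c) ⟩
  filter (v <?_) X ++ filter (v <?_) Y       ≡⟨ filter-++ (v <?_) X Y ⟨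
  filter (v <?_) (X ++ Y)                    ∎)
  where open ≡-Reasoning

suffixMinima-remove-descent : ∀ P {a b} T → a ℤ.< b →
  suffixMinima (P ++ b ∷ a ∷ T) ≡ suffixMinima (P ++ a ∷ T)
suffixMinima-remove-descent P T a<b = suffixMinima-remove (λ { (b<a ∷ _) → ℤ.<-asym a<b b<a }) P

countAbove-swap-differs : ∀ v P {a b} T → a ℤ.< b →
  countAbove v (suffixMinima (P ++ a ∷ b ∷ T)) ≢ countAbove v (suffixMinima (P ++ b ∷ a ∷ T)) →
  All (b ℤ.<_) T × v ℤ.< b
countAbove-swap-differs v P {a} {b} T a<b differ with all? (b <?_) T
... | no b≮T =
  ⊥-elim (differ (cong (countAbove v) (trans x-side (sym (suffixMinima-remove-descent P T a<b)))))
  where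
  x-side : suffixMinima (P ++ a ∷ b ∷ T) ≡ suffixMinima (P ++ a ∷ T)
  x-side = begin
    suffixMinima (P ++ a ∷ b ∷ T)        ≡⟨ cong suffixMinima (++-assoc P [ a ] (b ∷ T)) ⟨
    suffixMinima ((P ++ [ a ]) ++ b ∷ T) ≡⟨ suffixMinima-remove b≮T (P ++ [ a ]) ⟩
    suffixMinima ((P ++ [ a ]) ++ T)     ≡⟨ cong suffixMinima (++-assoc P [ a ] T) ⟩
    suffixMinima (P ++ a ∷ T)            ∎
    where open ≡-Reasoning
... | yes b<T with v <? b
...   | yes v<b = b<T , v<b
...   | no v≮b = ⊥-elim (differ (begin
  countAbove v (suffixMinima (P ++ a ∷ b ∷ T))
    ≡⟨ cong (countAbove v) (suffixMinima-split (a<b ∷ a<T) P) ⟩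
  countAbove v (S ++ suffixMinima (b ∷ T))
    ≡⟨ cong (countAbove v ∘ (S ++_)) (suffixMinima-keep b<T) ⟩
  countAbove v (S ++ b ∷ suffixMinima T)
    ≡⟨ countAbove-skip S (suffixMinima T) v≮b ⟩
  countAbove v (S ++ suffixMinima T)
    ≡⟨ cong (countAbove v) (suffixMinima-split a<T P) ⟨
  countAbove v (suffixMinima (P ++ a ∷ T))
    ≡⟨ cong (countAbove v) (suffixMinima-remove-descent P T a<b) ⟨
  countAbove v (suffixMinima (P ++ b ∷ a ∷ T))
    ∎))
  where
  open ≡-Reasoning
  a<T = All.map (ℤ.<-trans a<b) b<T
  S = suffixMinima (P ++ [ a ])

τ-swap : ∀ P (a b : ℤ) Q → τ (P ++ a ∷ b ∷ Q) (suc (length P)) ≡ P ++ b ∷ a ∷ Q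
τ-swap [] a b Q = refl
τ-swap (c ∷ []) a b Q = refl
τ-swap (c ∷ d ∷ P) a b Q = cong (c ∷_) (τ-swap (d ∷ P) a b Q)

nth-second : ∀ P (a b : ℤ) l → nth (P ++ a ∷ b ∷ l) (suc (suc (length P))) ≡ just b
nth-second [] a b l = refl
nth-second (c ∷ P) a b l = nth-second P a b l

drop-second : ∀ P (a b : ℤ) l → drop (suc (suc (length P))) (P ++ a ∷ b ∷ l) ≡ l
drop-second [] a b l = refl
drop-second (c ∷ P) a b l = drop-second P a b l

firstBelow-++ : ∀ {c v} k T s → All (c ℤ.<_) T → v ℤ.< c →
  firstBelow c k (T ++ v ∷ s) ≡ just (k + length T)
firstBelow-++ {c} {v} k [] s [] v<c with v <? c
... | yes _ = cong just (sym (+-identityʳ k))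
... | no v≮c = ⊥-elim (v≮c v<c)
firstBelow-++ {c} k (t ∷ T) s (c<t ∷ c<T) v<c with t <? c
... | yes t<c = ⊥-elim (ℤ.<-asym c<t t<c)
... | no _ = trans (firstBelow-++ (suc k) T s c<T v<c) (cong just (sym (+-suc k (length T))))

ref-second : ∀ P {a b} T {v} s → All (b ℤ.<_) T → v ℤ.< b →
  ref (P ++ a ∷ b ∷ T ++ v ∷ s) (suc (suc (length P))) ≡ just (suc (length (P ++ a ∷ b ∷ T)))
ref-second P {a} {b} T {v} s b<T v<b
  rewrite nth-second P a b (T ++ v ∷ s) | drop-second P a b (T ++ v ∷ s) =
  trans (firstBelow-++ _ T s b<T v<b) (cong just position)
  where
  position : suc (suc (suc (length P))) + length T ≡ suc (length (P ++ a ∷ b ∷ T))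
  position = cong suc (sym (trans (length-++ P) (trans (+-suc (length P) _) (cong suc (+-suc (length P) _)))))

-- amin breaks ties towards the last occurrence of the minimum, hence ≤ on the left, < on the right.
MinAt : List ℤ → ℤ × ℕ → Set
MinAt l (m , g) =
  l ≡ take g l ++ m ∷ drop (suc g) l × length (take g l) ≡ g
  × All (m ℤ.≤_) (take g l) × All (m ℤ.<_) (drop (suc g) l)

amin-minAt : ∀ a as → MinAt (a ∷ as) (amin a as)
amin-minAt a [] = refl , refl , [] , []
amin-minAt a (b ∷ bs) with amin b bs | amin-minAt b bs
... | v , k | split , len , v≤L , v<R with a <? v
...   | yes a<v = refl , refl , [] , subst (All (a ℤ.<_)) (sym split)
          (All.++⁺ (All.map (ℤ.<-≤-trans a<v) v≤L) (a<v ∷ All.map (ℤ.<-trans a<v) v<R))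
...   | no a≮v = cong (a ∷_) split , cong suc len , ℤ.≮⇒≥ a≮v ∷ v≤L , v<R

record MinSplit (l : List ℤ) : Set where
  field
    left : List ℤ
    min : ℤ
    right : List ℤ
    split : l ≡ left ++ min ∷ right
    min≤left : All (min ℤ.≤_) left
    min<right : All (min ℤ.<_) right

  length-split : length l ≡ suc (length left + length right)
  length-split = trans (cong length split) (trans (length-++ left) (+-suc _ _))

  fuel-split : ∀ {f} → length l ≤ suc f → length left ≤ f × length right ≤ f
  fuel-split bound = ≤-trans (m≤m+n _ _) parts , ≤-trans (m≤n+m _ _) parts
    where parts = ≤-pred (subst (_≤ _) length-split bound)

  module _ (u : Unique l) where
    private
      parts = Unique-++-∷⁻ left (subst Unique split u)

    unique-left : Unique left
    unique-left = proj₁ parts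

    unique-right : Unique right
    unique-right = proj₁ (proj₂ parts)

    min<left : All (min ℤ.<_) left
    min<left = All.zipWith (λ (m≤c , c≢m) → ℤ.≤∧≢⇒< m≤c (≢-sym c≢m))
                           (min≤left , proj₂ (proj₂ parts))

cartAux-unfold : ∀ a as → Σ (MinSplit (a ∷ as)) λ s → let open MinSplit s in
  ∀ f off → cartAux (suc f) off (a ∷ as)
          ≡ node (cartAux f off left) (off + suc (length left)) (cartAux f (off + suc (length left)) right)
cartAux-unfold a as with amin a as | amin-minAt a as
... | m , g | split , len , m≤L , m<R =
  record { left = L ; min = m ; right = R ; split = split ; min≤left = m≤L ; min<right = m<R } ,
  λ f off → cong (λ n → node (cartAux f off L) (off + suc n) (cartAux f (off + suc n) R)) (sym len)
  where
  L = take g (a ∷ as)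
  R = drop (suc g) (a ∷ as)

rightBranch-cartAux : ∀ f off l → length l ≤ f → rightBranch (cartAux f off l) ≡ length (suffixMinima l)
rightBranch-cartAux zero off [] _ = refl
rightBranch-cartAux (suc f) off [] _ = refl
rightBranch-cartAux (suc f) off (a ∷ as) bound with cartAux-unfold a as
... | s , unfold = begin
  rightBranch (cartAux (suc f) off (a ∷ as))
    ≡⟨ cong rightBranch (unfold f off) ⟩
  suc (rightBranch (cartAux f _ right))
    ≡⟨ cong suc (rightBranch-cartAux f _ right (proj₂ (fuel-split bound))) ⟩
  suc (length (suffixMinima right))
    ≡⟨ cong length (suffixMinima-at-minimum left min≤left min<right) ⟨
  length (suffixMinima (left ++ min ∷ right))
    ≡⟨ cong (length ∘ suffixMinima) split ⟨
  length (suffixMinima (a ∷ as))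
    ∎
  where
  open ≡-Reasoning
  open MinSplit s

subtree-root : ∀ l k r → subtree k (node l k r) ≡ just (node l k r)
subtree-root l k r with k ≟ k
... | yes _ = refl
... | no k≢k = ⊥-elim (k≢k refl)

subtree-left : ∀ {h l k r t} → h ≢ k → subtree h l ≡ just t → subtree h (node l k r) ≡ just t
subtree-left {h} {k = k} h≢k found with h ≟ k
... | yes h≡k = ⊥-elim (h≢k h≡k)
... | no _ rewrite found = refl

subtree-right : ∀ {h l k r} → h ≢ k → subtree h l ≡ nothing → subtree h (node l k r) ≡ subtree h r
subtree-right {h} {k = k} h≢k absent with h ≟ k
... | yes h≡k = ⊥-elim (h≢k h≡k)
... | no _ rewrite absent = refl

subtree-cartAux-outside : ∀ f off l h → h ≤ off ⊎ off + length l < h →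
  subtree h (cartAux f off l) ≡ nothing
subtree-cartAux-outside zero off l h _ = refl
subtree-cartAux-outside (suc f) off [] h _ = refl
subtree-cartAux-outside (suc f) off (a ∷ as) h outside with cartAux-unfold a as
... | s , unfold = trans (cong (subtree h) (unfold f off)) (trans
  (subtree-right (h≢root outside) (subtree-cartAux-outside f off left h (left-outside outside)))
        (subtree-cartAux-outside f (off + suc (length left)) right h (right-outside outside)))
  where
  open MinSplit s
  n = length left
  r = length right
  n<l : n < length (a ∷ as)
  n<l = subst (n <_) (sym length-split) (s≤s (m≤m+n n r))
  h≢root : h ≤ off ⊎ off + length (a ∷ as) < h → h ≢ off + suc n
  h≢root (inj₁ h≤off) = <⇒≢ (≤-<-trans h≤off (m<m+n off (s≤s z≤n)))
  h≢root (inj₂ l<h) = ≢-sym (<⇒≢ (≤-<-trans (+-monoʳ-≤ off n<l) l<h))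
  left-outside : h ≤ off ⊎ off + length (a ∷ as) < h → h ≤ off ⊎ off + n < h
  left-outside (inj₁ h≤off) = inj₁ h≤off
  left-outside (inj₂ l<h) = inj₂ (<-trans (+-monoʳ-< off n<l) l<h)
  right-outside : h ≤ off ⊎ off + length (a ∷ as) < h → h ≤ off + suc n ⊎ off + suc n + r < h
  right-outside (inj₁ h≤off) = inj₁ (≤-trans h≤off (m≤m+n off (suc n)))
  right-outside (inj₂ l<h) =
    inj₂ (subst (_< h) (trans (cong (off +_) length-split) (sym (+-assoc off (suc n) r))) l<h)

SNAt : Tree → ℕ → ℕ → Set
SNAt t h n = ∃[ l ] ∃[ r ] (subtree h t ≡ just (node l h r) × rightBranch l ≡ n)

SNAt-root : ∀ l k r → SNAt (node l k r) k (rightBranch l)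
SNAt-root l k r = l , r , subtree-root l k r , refl

SNAt-left : ∀ {h l k r n} → h ≢ k → SNAt l h n → SNAt (node l k r) h n
SNAt-left h≢k (l′ , r′ , found , spine) = l′ , r′ , subtree-left h≢k found , spine

SNAt-right : ∀ {h l k r n} → h ≢ k → subtree h l ≡ nothing → SNAt r h n → SNAt (node l k r) h n
SNAt-right h≢k absent (l′ , r′ , found , spine) = l′ , r′ , trans (subtree-right h≢k absent) found , spine

SNAt-cartAux : ∀ f off l p v s → Unique l → length l ≤ f → l ≡ p ++ v ∷ s →
  SNAt (cartAux f off l) (off + suc (length p)) (countAbove v (suffixMinima p))
SNAt-cartAux f off [] p v s _ _ e = ⊥-elim ([]≢++-∷ p e)
SNAt-cartAux zero off (a ∷ as) p v s _ () e
SNAt-cartAux (suc f) off (a ∷ as) p v s u bound e with cartAux-unfold a as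
... | ms@record { left = L ; min = m ; right = R } , unfold =
  subst (λ t → SNAt t (off + suc (length p)) (countAbove v (suffixMinima p))) (sym (unfold f off))
    (by-position (split-order p L (trans (sym e) split)))
  where
  open MinSplit ms
  T = node (cartAux f off L) (off + suc (length L)) (cartAux f (off + suc (length L)) R)
  by-position : SplitOrder p v s L m R → SNAt T (off + suc (length p)) (countAbove v (suffixMinima p))
  by-position (before t refl refl) =
    SNAt-left (<⇒≢ (+-monoʳ-< off (s≤s p<L)))
      (SNAt-cartAux f off L p v t (unique-left u) (proj₁ (fuel-split bound)) refl)
    where
    p<L : length p < length (p ++ v ∷ t)
    p<L = subst (length p <_) (sym (length-++ p)) (m<m+n (length p) (s≤s z≤n))
  by-position (same refl refl refl) = subst (SNAt T _) spine (SNAt-root _ _ _)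
    where
    spine : rightBranch (cartAux f off L) ≡ countAbove m (suffixMinima L)
    spine = trans (rightBranch-cartAux f off L (proj₁ (fuel-split bound)))
                  (cong length (sym (filter-all (m <?_) (All-suffixMinima (min<left u)))))
  by-position (after t refl refl) =
    subst₂ (SNAt T) (sym position) (sym skip-min)
      (SNAt-right (≢-sym (<⇒≢ (m<m+n _ (s≤s z≤n)))) (subtree-cartAux-outside f off L _ (inj₂ left<k))
        (SNAt-cartAux f (off + suc (length L)) R t v s (unique-right u) (proj₂ (fuel-split bound)) refl))
    where
    position : off + suc (length (L ++ m ∷ t)) ≡ off + suc (length L) + suc (length t)
    position = trans (cong (λ n → off + suc n) (length-++ L))
                     (sym (+-assoc off (suc (length L)) (suc (length t))))
    left<k : off + length L < off + suc (length L) + suc (length t)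
    left<k = ≤-trans (+-monoʳ-< off (n<1+n _)) (m≤m+n _ _)
    skip-min : countAbove v (suffixMinima (L ++ m ∷ t)) ≡ countAbove v (suffixMinima t)
    skip-min = trans (cong (countAbove v) (suffixMinima-at-minimum L min≤left (All.++⁻ˡ t min<right)))
                     (countAbove-skip [] _ (ℤ.<-asym (All.head (All.++⁻ʳ t min<right))))

SN-at : ∀ x {h n} → SNAt (C x) h n → SN x h ≡ n
SN-at x (l , r , found , refl) rewrite found = refl

SN-outside : ∀ x h → h ≤ 0 ⊎ length x < h → SN x h ≡ 0
SN-outside x h outside rewrite subtree-cartAux-outside (length x) 0 x h outside = refl

SN-suffixMinima : ∀ {x} p v s → Unique x → x ≡ p ++ v ∷ s →
  SN x (suc (length p)) ≡ countAbove v (suffixMinima p)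
SN-suffixMinima {x} p v s u e = SN-at x (SNAt-cartAux (length x) 0 x p v s u ≤-refl e)

SN-swap-beyond : ∀ P {a b} T v s → a ℤ.< b → Unique (P ++ a ∷ b ∷ T ++ v ∷ s) →
  let j = suc (length (P ++ a ∷ b ∷ T)) in
  SN (P ++ a ∷ b ∷ T ++ v ∷ s) j ≢ SN (P ++ b ∷ a ∷ T ++ v ∷ s) j →
  just j ≡ ref (P ++ a ∷ b ∷ T ++ v ∷ s) (suc (suc (length P)))
SN-swap-beyond P {a} {b} T v s a<b u differ = sym (ref-second P T s (proj₁ above) (proj₂ above))
  where
  y-SN : SN (P ++ b ∷ a ∷ T ++ v ∷ s) (suc (length (P ++ a ∷ b ∷ T)))
       ≡ countAbove v (suffixMinima (P ++ b ∷ a ∷ T))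
  y-SN = subst (λ j → SN (P ++ b ∷ a ∷ T ++ v ∷ s) j ≡ countAbove v (suffixMinima (P ++ b ∷ a ∷ T)))
           (cong suc (trans (length-++ P) (sym (length-++ P))))
           (SN-suffixMinima (P ++ b ∷ a ∷ T) v s (Unique-swap P _ u) (sym (++-assoc P (b ∷ a ∷ T) (v ∷ s))))
  x-SN = SN-suffixMinima (P ++ a ∷ b ∷ T) v s u (sym (++-assoc P (a ∷ b ∷ T) (v ∷ s)))
  above = countAbove-swap-differs v P T a<b λ same → differ (trans x-SN (trans same (sym y-SN)))

module _ (P : List ℤ) {a b : ℤ} (Q : List ℤ) where
  private
    x y : List ℤ
    x = P ++ a ∷ b ∷ Q
    y = P ++ b ∷ a ∷ Q

  SN-swap-differs : a ℤ.< b → Unique x → ∀ j → SN x j ≢ SN y j →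
    j ≡ suc (length P) ⊎ j ≡ suc (suc (length P)) ⊎ just j ≡ ref x (suc (suc (length P)))
  SN-swap-differs a<b u zero differ =
    ⊥-elim (differ (trans (SN-outside x 0 (inj₁ z≤n)) (sym (SN-outside y 0 (inj₁ z≤n)))))
  SN-swap-differs a<b u (suc k) differ with k ℕ.<? length x
  ... | no k≮x =
    ⊥-elim (differ (trans (SN-outside x _ (inj₂ (s≤s x≤k))) (sym (SN-outside y _ (inj₂ (s≤s y≤k))))))
    where
    x≤k = ≮⇒≥ k≮x
    y≤k = subst (_≤ k) (trans (length-++ P) (sym (length-++ P))) x≤k
  ... | yes k<x with split-at k x k<x
  ...   | p , v , s , x≡ , refl with split-order p P (sym x≡)
  ...     | before t refl refl = ⊥-elim (differ (trans (SN-suffixMinima p v _ u x≡)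
              (sym (SN-suffixMinima p v _ (Unique-swap P Q u) (++-assoc p (v ∷ t) (b ∷ a ∷ Q))))))
  ...     | same refl _ _ = inj₁ refl
  ...     | after [] refl _ = inj₂ (inj₁ (cong suc (trans (length-++ P) (+-comm (length P) 1))))
  ...     | after (_ ∷ T) refl refl = inj₂ (inj₂ (SN-swap-beyond P T v s a<b u differ))

SN-swap-candidates : ∀ P (a b : ℤ) Q → Unique (P ++ a ∷ b ∷ Q) → let i = suc (length P) in
  ∃[ r ] ((r ≡ ref (P ++ a ∷ b ∷ Q) (suc i) ⊎ r ≡ ref (P ++ b ∷ a ∷ Q) (suc i))
          × ∀ j → SN (P ++ a ∷ b ∷ Q) j ≢ SN (P ++ b ∷ a ∷ Q) j → j ≡ i ⊎ j ≡ suc i ⊎ just j ≡ r)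
SN-swap-candidates P a b Q u with ℤ.<-cmp a b
... | tri< a<b _ _ = _ , inj₁ refl , SN-swap-differs P Q a<b u
... | tri≈ _ refl _ = _ , inj₁ refl , λ _ differ → ⊥-elim (differ refl)
... | tri> _ _ b<a = _ , inj₂ refl , λ j → SN-swap-differs P Q b<a (Unique-swap P Q u) j ∘ (_∘ sym)

lemma17 : (x : List ℤ) → Unique x → (i : ℕ) → 1 ≤ i → i < length x →
    (length (filter (λ j → ¬? (SN x j ≟ SN (τ x i) j)) (map suc (upTo (length x)))) ≤ 3)
    × (∀ j → 1 ≤ j → j ≤ length x → SN x j ≢ SN (τ x i) j →
        (j ≡ i) ⊎ (j ≡ suc i) ⊎ (just j ≡ ref x i) ⊎ (just j ≡ ref x (suc i))
        ⊎ (just j ≡ ref (τ x i) i) ⊎ (just j ≡ ref (τ x i) (suc i)))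
lemma17 x u zero () _
lemma17 x u (suc n) _ i<x with split-at-pair n x i<x
... | P , a , b , Q , refl , refl rewrite τ-swap P a b Q with SN-swap-candidates P a b Q u
... | r , r-is-ref , differs =
  length-filter-≤3 (λ j → ¬? (SN x j ≟ SN (P ++ b ∷ a ∷ Q) j))
    (map⁺ suc-injective (upTo⁺ (length x))) (differs _) ,
  λ j _ _ → Sum.map₂ (Sum.map₂ (inj₂ ∘ [ inj₁ , inj₂ ∘ inj₂ ]′ ∘ λ e → Sum.map (trans e) (trans e) r-is-ref))
            ∘ differs j
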